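{- Consider a Vector-Max-GAP instance with item set $I$, $k$ machines of capacities $M_1,\dots,M_k$, sizes $s_j(i)$, values $\mathrm{val}_j(i)$, weights $\vec w(i)=(w_1(i),\dots,w_d(i))$ and global weight bound vector $\vec W=(W_1,\dots,W_d)$. Let $J$ be a feasible solution, with $J_j\subseteq J$ the items assigned to machine $j$. Then for every $\epsilon>0$ there exist sets $X$ and $Y$ such that $|X|\le (d+k)/\epsilon^2$, $\mathrm{val}(Y)\le\epsilon\cdot\mathrm{val}(J)$, and $$\forall j\in[k],\ \forall i\in J_j\setminus(X\cup Y):\ s_j(i)\le \epsilon\big(M_j-s_j(X\cap J_j)\big),$$ $$\forall i\in J\setminus(X\cup Y):\ \vec w(i)\le \epsilon\big(\vec W-\vec w(X)\big)\ \text{(componentwise)}.$$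
   Context: Vector-Max-GAP: items $I$, $k$ machines; machine $j$ has capacity $M_j\ge0$; item $i$ has size $s_j(i)\ge 0$ and value $\mathrm{val}_j(i)\ge0$ on machine $j$, and weight $w_q(i)\ge 0$ for $q\in[d]$. A feasible solution is $J\subseteq I$ with a partition $J=J_1\cup\dots\cup J_k$ such that $\sum_{i\in J_j}s_j(i)\le M_j$ and $\sum_{i\in J}w_q(i)\le W_q$ for all $j,q$. For a set $S$, $s_j(S)=\sum_{i\in S}s_j(i)$, $\vec w(S)=\sum_{i\in S}\vec w(i)$, and $\mathrm{val}(J)=\sum_j\sum_{i\in J_j}\mathrm{val}_j(i)$ (for subsets of $J$, values are taken with respect to the machines the items are assigned to in $J$).
   Formalization: The capacities, sizes, values, weights, global weight bounds and the parameter ε all take values in the rationals. -}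

module Defs where

open import Data.Nat using (ℕ; zero; suc)
open import Data.Fin using (Fin; zero; suc)
open import Data.Bool using (Bool; true; false; if_then_else_; _∧_)
open import Data.Maybe using (Maybe; just; nothing)
open import Data.Integer using (+_)
open import Data.Rational using (ℚ; 0ℚ; _+_; _/_)
open import Data.Fin using (_≟_)
open import Relation.Nullary.Decidable using (⌊_⌋)

sumFin : {n : ℕ} → (Fin n → ℚ) → ℚ
sumFin {zero}  f = 0ℚ
sumFin {suc n} f = f zero + sumFin (λ i → f (suc i))

count : {n : ℕ} → (Fin n → Bool) → ℕ
count {zero}  P = 0
count {suc n} P = (if P zero then 1 else 0) Data.Nat.+ count (λ i → P (suc i))

toℚ : ℕ → ℚ
toℚ m = (+ m) / 1

sumOver : {n : ℕ} → (Fin n → Bool) → (Fin n → ℚ) → ℚ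
sumOver S f = sumFin (λ i → if S i then f i else 0ℚ)

record Instance (n k d : ℕ) : Set where
  field
    M   : Fin k → ℚ
    s   : Fin k → Fin n → ℚ
    val : Fin k → Fin n → ℚ
    w   : Fin d → Fin n → ℚ
    W   : Fin d → ℚ

-- An assignment: item i is unassigned (nothing, i ∉ J) or put on machine j.
Assignment : ℕ → ℕ → Set
Assignment n k = Fin n → Maybe (Fin k)

onMachine : {n k : ℕ} → Assignment n k → Fin k → Fin n → Bool
onMachine A j i with A i
... | nothing = false
... | just j' = ⌊ j ≟ j' ⌋

inJ : {n k : ℕ} → Assignment n k → Fin n → Bool
inJ A i with A i
... | nothing = false
... | just _  = true

assignedVal : {n k d : ℕ} → Instance n k d → Assignment n k → Fin n → ℚ
assignedVal I A i with A i
... | nothing = 0ℚ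
... | just j  = Instance.val I j i

-- Grow a set X ⊆ J in rounds. Given X, call an item i ∈ J ∖ X large if it exceeds an ε-fraction of
-- a residual budget: s_j(i) > ε (M_j − s_j(X ∩ J_j)) for its machine j, or w_q(i) > ε (W_q − w_q(X))
-- for some q. The large items of one budget fit together into that residual budget, so there are at
-- most 1/ε of them, and at most (d + k)/ε large items Y in all. If val(Y) ≤ ε val(J) we stop with
-- (X, Y); otherwise we move Y into X. Each such round adds more than ε val(J) to val(X) ≤ val(J), so
-- there are at most 1/ε rounds, and |X| ≤ (d + k)/ε².

module Submission where

open import Defs
open import Data.Nat as ℕ using (ℕ; zero; suc)
import Data.Nat.Properties as ℕₚ
import Data.Nat.Coprimality as Coprime
open import Data.Integer as ℤ using ()
import Data.Integer.Properties as ℤₚ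
open import Data.Fin using (Fin; zero; suc) renaming (_≟_ to _≟ᶠ_)
open import Data.Bool using (Bool; true; false; _∧_; _∨_; not; if_then_else_)
open import Data.Bool.Properties using (∧-conicalˡ; ∧-conicalʳ; ∨-conicalˡ; ∨-conicalʳ; not-injective)
open import Data.Maybe using (just; nothing)
open import Data.Product using (Σ; _×_; _,_)
open import Data.Sum using (_⊎_; inj₁; inj₂; map₂)
open import Data.Empty using (⊥-elim)
open import Data.Rational using (ℚ; 0ℚ; 1ℚ; _+_; _*_; _-_; -_; _≤_; _<_; _≤?_; _<?_; nonNegative)
open import Data.Rational.Properties
open import Data.Rational.Solver using (module +-*-Solver)
open +-*-Solver using (solve; _:+_; _:*_; _:=_; con)
open import Algebra.Bundles using (Ring)
open import Algebra.Properties.Semiring.Sum (Ring.semiring +-*-ring)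
  using (sum; sum-cong-≗; sum-replicate-zero; ∑-distrib-+; *-distribˡ-sum)
open import Function using (_∘_)
open import Relation.Nullary using (¬_; Dec; yes; no)
open import Relation.Nullary.Decidable using (⌊_⌋; isYes≗does; dec-true)
open import Relation.Binary.PropositionalEquality

private variable
  n : ℕ

toℚ-suc : ∀ m → toℚ (suc m) ≡ 1ℚ + toℚ m
toℚ-suc m rewrite normalize-coprime (Coprime.sym (Coprime.1-coprimeTo m)) =
  sym (/-cong (cong (ℤ._+_ (ℤ.+ 1)) (ℤₚ.*-identityʳ (ℤ.+ m))) refl)

toℚ-nonNeg : ∀ m → 0ℚ ≤ toℚ m
toℚ-nonNeg m = nonNegative⁻¹ (toℚ m) {{normalize-nonNeg m 1}}

0≤1 : 0ℚ ≤ 1ℚ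
0≤1 = nonNegative⁻¹ 1ℚ

p+q≤r⇒p≤r-q : ∀ {p q r} → p + q ≤ r → p ≤ r - q
p+q≤r⇒p≤r-q {p} {q} {r} p+q≤r = subst (_≤ r - q) p+q-q≡p (+-monoˡ-≤ (- q) p+q≤r)
  where
  p+q-q≡p : p + q - q ≡ p
  p+q-q≡p = trans (+-assoc p q (- q)) (trans (cong (p +_) (+-inverseʳ q)) (+-identityʳ p))

dec-true⁻¹ : {P : Set} (P? : Dec P) → ⌊ P? ⌋ ≡ true → P
dec-true⁻¹ (yes p) _ = p

dec-false⁻¹ : {P : Set} (P? : Dec P) → ⌊ P? ⌋ ≡ false → ¬ P
dec-false⁻¹ (no ¬p) _ = ¬p

sumFin≡sum : {n : ℕ} (f : Fin n → ℚ) → sumFin f ≡ sum f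
sumFin≡sum {zero}  f = refl
sumFin≡sum {suc n} f = cong (f zero +_) (sumFin≡sum (f ∘ suc))

sumFin-cong : {f g : Fin n → ℚ} → (∀ i → f i ≡ g i) → sumFin f ≡ sumFin g
sumFin-cong {f = f} {g} f≗g = trans (sumFin≡sum f) (trans (sum-cong-≗ f≗g) (sym (sumFin≡sum g)))

sumFin-+ : (f g : Fin n → ℚ) → sumFin (λ i → f i + g i) ≡ sumFin f + sumFin g
sumFin-+ f g = begin
  sumFin (λ i → f i + g i)  ≡⟨ sumFin≡sum (λ i → f i + g i) ⟩
  sum (λ i → f i + g i)     ≡⟨ ∑-distrib-+ f g ⟩
  sum f + sum g             ≡⟨ cong₂ _+_ (sumFin≡sum f) (sumFin≡sum g) ⟨
  sumFin f + sumFin g       ∎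
  where open ≡-Reasoning

*-distribˡ-sumFin : (c : ℚ) (f : Fin n → ℚ) → c * sumFin f ≡ sumFin (λ i → c * f i)
*-distribˡ-sumFin c f = begin
  c * sumFin f              ≡⟨ cong (c *_) (sumFin≡sum f) ⟩
  c * sum f                 ≡⟨ *-distribˡ-sum c f ⟩
  sum (λ i → c * f i)       ≡⟨ sumFin≡sum (λ i → c * f i) ⟨
  sumFin (λ i → c * f i)    ∎
  where open ≡-Reasoning

sumFin-mono : {n : ℕ} {f g : Fin n → ℚ} → (∀ i → f i ≤ g i) → sumFin f ≤ sumFin g
sumFin-mono {zero}  f≤g = ≤-refl
sumFin-mono {suc n} f≤g = +-mono-≤ (f≤g zero) (sumFin-mono (f≤g ∘ suc))

sumFin-zero : {n : ℕ} → sumFin {n} (λ _ → 0ℚ) ≡ 0ℚ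
sumFin-zero {n} = trans (sumFin≡sum {n} (λ _ → 0ℚ)) (sum-replicate-zero n)

sumFin-nonNeg : {n : ℕ} {f : Fin n → ℚ} → (∀ i → 0ℚ ≤ f i) → 0ℚ ≤ sumFin f
sumFin-nonNeg {n} {f} f≥0 = subst (_≤ sumFin f) (sumFin-zero {n}) (sumFin-mono f≥0)

Subset : ℕ → Set
Subset n = Fin n → Bool

private variable
  A S T X : Subset n
  f : Fin n → ℚ

∅ : Subset n
∅ _ = false

infixr 6 _∪_
infixr 7 _∩_
infix 4 _⊆_

_∪_ : Subset n → Subset n → Subset n
(S ∪ T) i = S i ∨ T i

_∩_ : Subset n → Subset n → Subset n
(S ∩ T) i = S i ∧ T i

_⊆_ : Subset n → Subset n → Set
S ⊆ T = ∀ i → S i ≡ true → T i ≡ true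

Disjoint : Subset n → Subset n → Set
Disjoint S T = ∀ i → S i ≡ true → T i ≡ false

card : Subset n → ℚ
card S = sumOver S (λ _ → 1ℚ)

∪-⊆ : S ⊆ A → T ⊆ A → S ∪ T ⊆ A
∪-⊆ {S = S} S⊆A T⊆A i with S i in Sᵢ
... | true  = λ _ → S⊆A i Sᵢ
... | false = T⊆A i

∩-⊆ʳ : S ∩ T ⊆ T
∩-⊆ʳ {S = S} {T = T} i = ∧-conicalʳ (S i) (T i)

∪-Disjoint : Disjoint S X → Disjoint T X → Disjoint (S ∪ T) X
∪-Disjoint {S = S} S∩X≡∅ T∩X≡∅ i with S i in Sᵢ
... | true  = λ _ → S∩X≡∅ i Sᵢ
... | false = T∩X≡∅ i

⊆-trans : S ⊆ T → T ⊆ A → S ⊆ A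
⊆-trans S⊆T T⊆A i = T⊆A i ∘ S⊆T i

Disjoint-∩ˡ : {B : Subset n} → Disjoint S X → Disjoint S (X ∩ B)
Disjoint-∩ˡ S∩X≡∅ i Sᵢ rewrite S∩X≡∅ i Sᵢ = refl

count≤n : {n : ℕ} (S : Subset n) → count S ℕ.≤ n
count≤n {zero}  S = ℕ.z≤n
count≤n {suc n} S with S zero
... | true  = ℕ.s≤s (count≤n (S ∘ suc))
... | false = ℕₚ.m≤n⇒m≤1+n (count≤n (S ∘ suc))

count-∅ : {n : ℕ} → count (∅ {n}) ≡ 0
count-∅ {zero}  = refl
count-∅ {suc n} = count-∅ {n}

count-∪ : {n : ℕ} {S T : Subset n} → Disjoint S T → count (S ∪ T) ≡ count S ℕ.+ count T
count-∪ {zero}  _ = refl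
count-∪ {suc n} {S} {T} S∩T≡∅ with S zero in S₀ | T zero in T₀
... | true  | true  with () ← trans (sym (S∩T≡∅ zero S₀)) T₀
... | true  | false = cong suc (count-∪ (S∩T≡∅ ∘ suc))
... | false | true  = trans (cong suc (count-∪ (S∩T≡∅ ∘ suc))) (sym (ℕₚ.+-suc _ _))
... | false | false = count-∪ (S∩T≡∅ ∘ suc)

toℚ-count : {n : ℕ} (S : Subset n) → toℚ (count S) ≡ card S
toℚ-count {zero}  S = refl
toℚ-count {suc n} S with S zero
... | true  = trans (toℚ-suc (count (S ∘ suc))) (cong (1ℚ +_) (toℚ-count (S ∘ suc)))
... | false = trans (toℚ-count (S ∘ suc)) (sym (+-identityˡ _))

count≡0⇒sumOver≡0 : {n : ℕ} (S : Subset n) (f : Fin n → ℚ) → count S ≡ 0 → sumOver S f ≡ 0ℚ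
count≡0⇒sumOver≡0 {zero}  S f _ = refl
count≡0⇒sumOver≡0 {suc n} S f ∣S∣≡0 with S zero
... | false = trans (+-identityˡ _) (count≡0⇒sumOver≡0 (S ∘ suc) (f ∘ suc) ∣S∣≡0)

sumOver-∅ : {n : ℕ} (f : Fin n → ℚ) → sumOver ∅ f ≡ 0ℚ
sumOver-∅ {n} _ = sumFin-zero {n}

sumOver-nonNeg : (∀ i → 0ℚ ≤ f i) → 0ℚ ≤ sumOver S f
sumOver-nonNeg {S = S} f≥0 = sumFin-nonNeg λ i → pointwise (S i) (f≥0 i)
  where
  pointwise : ∀ b {v} → 0ℚ ≤ v → 0ℚ ≤ (if b then v else 0ℚ)
  pointwise true  v≥0 = v≥0
  pointwise false _   = ≤-refl

sumOver-⊆ : (∀ i → 0ℚ ≤ f i) → S ⊆ T → sumOver S f ≤ sumOver T f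
sumOver-⊆ {S = S} {T = T} f≥0 S⊆T = sumFin-mono λ i → pointwise (S i) (T i) (S⊆T i) (f≥0 i)
  where
  pointwise : ∀ a b {v} → (a ≡ true → b ≡ true) → 0ℚ ≤ v →
              (if a then v else 0ℚ) ≤ (if b then v else 0ℚ)
  pointwise true  true  _   _   = ≤-refl
  pointwise true  false a⇒b _   with () ← a⇒b refl
  pointwise false true  _   v≥0 = v≥0
  pointwise false false _   _   = ≤-refl

sumOver-∪ : Disjoint S T → sumOver (S ∪ T) f ≡ sumOver S f + sumOver T f
sumOver-∪ {S = S} {T = T} {f = f} S∩T≡∅ =
  trans (sumFin-cong λ i → pointwise (S i) (T i) (S∩T≡∅ i))
        (sumFin-+ (λ i → if S i then f i else 0ℚ) (λ i → if T i then f i else 0ℚ))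
  where
  pointwise : ∀ a b {v} → (a ≡ true → b ≡ false) →
              (if a ∨ b then v else 0ℚ) ≡ (if a then v else 0ℚ) + (if b then v else 0ℚ)
  pointwise true  true  a⇒¬b with () ← a⇒¬b refl
  pointwise true  false _ = sym (+-identityʳ _)
  pointwise false true  _ = sym (+-identityˡ _)
  pointwise false false _ = sym (+-identityˡ _)

sumOver-∪-≤ : (∀ i → 0ℚ ≤ f i) → sumOver (S ∪ T) f ≤ sumOver S f + sumOver T f
sumOver-∪-≤ {f = f} {S = S} {T = T} f≥0 =
  subst (sumOver (S ∪ T) f ≤_)
        (sumFin-+ (λ i → if S i then f i else 0ℚ) (λ i → if T i then f i else 0ℚ))
        (sumFin-mono λ i → pointwise (S i) (T i) (f≥0 i))
  where
  pointwise : ∀ a b {v} → 0ℚ ≤ v →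
              (if a ∨ b then v else 0ℚ) ≤ (if a then v else 0ℚ) + (if b then v else 0ℚ)
  pointwise true  true  {v} v≥0 = subst (_≤ v + v) (+-identityʳ v) (+-monoʳ-≤ v v≥0)
  pointwise true  false _   = ≤-reflexive (sym (+-identityʳ _))
  pointwise false true  _   = ≤-reflexive (sym (+-identityˡ _))
  pointwise false false _   = ≤-reflexive (sym (+-identityˡ _))

*-card-∪-≤ : {ε : ℚ} → 0ℚ ≤ ε → (S T : Subset n) → ε * card (S ∪ T) ≤ ε * card S + ε * card T
*-card-∪-≤ {ε = ε} ε≥0 S T = begin
  ε * card (S ∪ T)           ≤⟨ *-monoˡ-≤-nonNeg ε {{nonNegative ε≥0}}
                                  (sumOver-∪-≤ {S = S} {T = T} (λ _ → 0≤1)) ⟩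
  ε * (card S + card T)      ≡⟨ *-distribˡ-+ ε (card S) (card T) ⟩
  ε * card S + ε * card T    ∎
  where open ≤-Reasoning

⋃ : {m : ℕ} → (Fin m → Subset n) → Subset n
⋃ {m = zero}  F = ∅
⋃ {m = suc m} F = F zero ∪ ⋃ (F ∘ suc)

⋃-⊆ : {m : ℕ} {F : Fin m → Subset n} → (∀ j → F j ⊆ A) → ⋃ F ⊆ A
⋃-⊆ {m = zero}  F⊆A i ()
⋃-⊆ {m = suc m} F⊆A = ∪-⊆ (F⊆A zero) (⋃-⊆ (F⊆A ∘ suc))

⋃-Disjoint : {m : ℕ} {F : Fin m → Subset n} → (∀ j → Disjoint (F j) X) → Disjoint (⋃ F) X
⋃-Disjoint {m = zero}  _ i ()
⋃-Disjoint {m = suc m} F∩X≡∅ = ∪-Disjoint (F∩X≡∅ zero) (⋃-Disjoint (F∩X≡∅ ∘ suc))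

⋃≡false : {m : ℕ} (F : Fin m → Subset n) (i : Fin n) → ⋃ F i ≡ false → ∀ j → F j i ≡ false
⋃≡false F i ⋃Fᵢ≡false zero    = ∨-conicalˡ (F zero i) _ ⋃Fᵢ≡false
⋃≡false F i ⋃Fᵢ≡false (suc j) = ⋃≡false (F ∘ suc) i (∨-conicalʳ (F zero i) _ ⋃Fᵢ≡false) j

*-card-⋃≤ : {n m : ℕ} {F : Fin m → Subset n} {ε : ℚ} → 0ℚ ≤ ε →
            (∀ j → ε * card (F j) ≤ 1ℚ) → ε * card (⋃ F) ≤ toℚ m
*-card-⋃≤ {n} {zero}  {ε = ε} _ _ =
  ≤-reflexive (trans (cong (ε *_) (sumOver-∅ {n} (λ _ → 1ℚ))) (*-zeroʳ ε))
*-card-⋃≤ {n} {suc m} {F} {ε} ε≥0 εF≤1 = begin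
  ε * card (F zero ∪ ⋃ (F ∘ suc))             ≤⟨ *-card-∪-≤ ε≥0 (F zero) (⋃ (F ∘ suc)) ⟩
  ε * card (F zero) + ε * card (⋃ (F ∘ suc))  ≤⟨ +-mono-≤ (εF≤1 zero) (*-card-⋃≤ {F = F ∘ suc} ε≥0 (εF≤1 ∘ suc)) ⟩
  1ℚ + toℚ m                                  ≡⟨ toℚ-suc m ⟨
  toℚ (suc m)                                 ∎
  where open ≤-Reasoning

-- Few items exceed a fraction of a budget

*-card≤sumOver : {a : ℚ} → (∀ i → S i ≡ true → a ≤ f i) → a * card S ≤ sumOver S f
*-card≤sumOver {S = S} {f = f} {a} a≤f = begin
  a * card S                                     ≡⟨ *-distribˡ-sumFin a (λ i → if S i then 1ℚ else 0ℚ) ⟩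
  sumFin (λ i → a * (if S i then 1ℚ else 0ℚ))    ≤⟨ sumFin-mono (λ i → pointwise (S i) (a≤f i)) ⟩
  sumOver S f                                    ∎
  where
  open ≤-Reasoning
  pointwise : ∀ b {v} → (b ≡ true → a ≤ v) → a * (if b then 1ℚ else 0ℚ) ≤ (if b then v else 0ℚ)
  pointwise true  {v} a≤v = subst (_≤ v) (sym (*-identityʳ a)) (a≤v refl)
  pointwise false _       = ≤-reflexive (*-zeroʳ a)

count≡0⊎*card<sumOver : {n : ℕ} (S : Subset n) (f : Fin n → ℚ) {a : ℚ} →
                        (∀ i → S i ≡ true → a < f i) → count S ≡ 0 ⊎ a * card S < sumOver S f
count≡0⊎*card<sumOver {zero}  S f a<f = inj₁ refl
count≡0⊎*card<sumOver {suc n} S f {a} a<f with S zero in S₀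
... | true  = inj₂ (begin-strict
  a * (1ℚ + card (S ∘ suc))              ≡⟨ *-distribˡ-+ a 1ℚ (card (S ∘ suc)) ⟩
  a * 1ℚ + a * card (S ∘ suc)            ≡⟨ cong (_+ a * card (S ∘ suc)) (*-identityʳ a) ⟩
  a + a * card (S ∘ suc)                 <⟨ +-mono-<-≤ (a<f zero S₀) (*-card≤sumOver (λ i → <⇒≤ ∘ a<f (suc i))) ⟩
  f zero + sumOver (S ∘ suc) (f ∘ suc)   ∎)
  where open ≤-Reasoning
... | false = map₂ (subst₂ _<_ (cong (a *_) (sym (+-identityˡ _))) (sym (+-identityˡ _)))
                   (count≡0⊎*card<sumOver (S ∘ suc) (f ∘ suc) (a<f ∘ suc))

*-card≤1 : {R ε : ℚ} → (∀ i → 0ℚ ≤ f i) → (∀ i → S i ≡ true → ε * R < f i) →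
           sumOver S f ≤ R → ε * card S ≤ 1ℚ
*-card≤1 {f = f} {S = S} {R} {ε} f≥0 exceeds S≤R with count≡0⊎*card<sumOver S f exceeds
... | inj₁ ∣S∣≡0 = begin
  ε * card S            ≡⟨ cong (ε *_) (trans (sym (toℚ-count S)) (cong toℚ ∣S∣≡0)) ⟩
  ε * 0ℚ                ≡⟨ *-zeroʳ ε ⟩
  0ℚ                    ≤⟨ 0≤1 ⟩
  1ℚ                    ∎
  where open ≤-Reasoning
... | inj₂ εRS<sumOver = <⇒≤ (*-cancelʳ-<-nonNeg R {{nonNegative R≥0}} (begin-strict
  ε * card S * R        ≡⟨ solve 3 (λ ε s R → ε :* s :* R := ε :* R :* s) refl ε (card S) R ⟩
  ε * R * card S        <⟨ εRS<sumOver ⟩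
  sumOver S f           ≤⟨ S≤R ⟩
  R                     ≡⟨ *-identityˡ R ⟨
  1ℚ * R                ∎))
  where
  open ≤-Reasoning
  R≥0 : 0ℚ ≤ R
  R≥0 = ≤-trans (sumOver-nonNeg f≥0) S≤R

*-card≤1-residual : {R ε : ℚ} → (∀ i → 0ℚ ≤ f i) → S ⊆ A → T ⊆ A → Disjoint S T →
                    sumOver A f ≤ R → (∀ i → S i ≡ true → ε * (R - sumOver T f) < f i) →
                    ε * card S ≤ 1ℚ
*-card≤1-residual {f = f} {S = S} {A = A} {T = T} {R} {ε} f≥0 S⊆A T⊆A S∩T≡∅ A≤R exceeds =
  *-card≤1 {ε = ε} f≥0 exceeds (p+q≤r⇒p≤r-q (begin
    sumOver S f + sumOver T f   ≡⟨ sumOver-∪ S∩T≡∅ ⟨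
    sumOver (S ∪ T) f           ≤⟨ sumOver-⊆ f≥0 (∪-⊆ S⊆A T⊆A) ⟩
    sumOver A f                 ≤⟨ A≤R ⟩
    R                           ∎))
  where open ≤-Reasoning

large : Subset n → Subset n → (Fin n → ℚ) → ℚ → Subset n
large A X f r i = A i ∧ not (X i) ∧ ⌊ r <? f i ⌋

module Large (A X : Subset n) (f : Fin n → ℚ) (r : ℚ) where

  large-⊆ : large A X f r ⊆ A
  large-⊆ i = ∧-conicalˡ (A i) _

  large-Disjoint : Disjoint (large A X f r) X
  large-Disjoint i largeᵢ =
    not-injective (∧-conicalˡ (not (X i)) _ (∧-conicalʳ (A i) _ largeᵢ))

  large-exceeds : ∀ i → large A X f r i ≡ true → r < f i
  large-exceeds i largeᵢ =
    dec-true⁻¹ (r <? f i) (∧-conicalʳ (not (X i)) _ (∧-conicalʳ (A i) _ largeᵢ))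

  ¬large⇒≤ : ∀ i → A i ≡ true → X i ≡ false → large A X f r i ≡ false → f i ≤ r
  ¬large⇒≤ i Aᵢ Xᵢ ¬largeᵢ =
    ≮⇒≥ (dec-false⁻¹ (r <? f i)
      (subst₂ (λ a x → a ∧ not x ∧ ⌊ r <? f i ⌋ ≡ false) Aᵢ Xᵢ ¬largeᵢ))

-- Peeling off large items

module Peeling {n : ℕ} (J : Subset n) (v : Fin n → ℚ) (v≥0 : ∀ i → 0ℚ ≤ v i)
  {ε D : ℚ} (ε≥0 : 0ℚ ≤ ε) (D≥0 : 0ℚ ≤ D)
  (L : Subset n → Subset n) (L⊆J : ∀ X → L X ⊆ J) (L-Disjoint : ∀ X → Disjoint (L X) X)
  (*-card-L≤D : ∀ X → X ⊆ J → ε * card (L X) ≤ D) where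

  V : ℚ
  V = sumOver J v

  V≥0 : 0ℚ ≤ V
  V≥0 = sumOver-nonNeg v≥0

  εV≥0 : 0ℚ ≤ ε * V
  εV≥0 = subst (_≤ ε * V) (*-zeroʳ ε) (*-monoˡ-≤-nonNeg ε {{nonNegative ε≥0}} V≥0)

  record Stage (t : ℚ) (X : Subset n) : Set where
    field
      X⊆J         : X ⊆ J
      card-bound  : ε * card X ≤ t * D
      value-bound : t * ε * V ≤ sumOver X v
      round-bound : t * ε ≤ 1ℚ

  start : Stage 0ℚ ∅
  start = record
    { X⊆J         = λ _ ()
    ; card-bound  = ≤-reflexive (trans (cong (ε *_) (sumOver-∅ {n} (λ _ → 1ℚ)))
                                       (trans (*-zeroʳ ε) (sym (*-zeroˡ D))))
    ; value-bound = ≤-reflexive (trans (solve 2 (λ ε V → con 0ℚ :* ε :* V := con 0ℚ) refl ε V)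
                                       (sym (sumOver-∅ {n} v)))
    ; round-bound = subst (_≤ 1ℚ) (sym (*-zeroˡ ε)) 0≤1
    }

  grow : ∀ {t X} → Stage t X → ε * V < sumOver (L X) v → Stage (1ℚ + t) (L X ∪ X)
  grow {t} {X} stage εV<L = record
    { X⊆J         = ∪-⊆ (L⊆J X) X⊆J
    ; card-bound  = card-grows
    ; value-bound = <⇒≤ value-grows
    ; round-bound = <⇒≤ (*-cancelʳ-<-nonNeg V {{nonNegative V≥0}} (begin-strict
        (1ℚ + t) * ε * V     <⟨ value-grows ⟩
        sumOver (L X ∪ X) v  ≤⟨ sumOver-⊆ v≥0 (∪-⊆ (L⊆J X) X⊆J) ⟩
        V                    ≡⟨ *-identityˡ V ⟨
        1ℚ * V               ∎))
    }
    where
    open Stage stage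
    open ≤-Reasoning

    card-grows : ε * card (L X ∪ X) ≤ (1ℚ + t) * D
    card-grows = begin
      ε * card (L X ∪ X)            ≡⟨ cong (ε *_) (sumOver-∪ (L-Disjoint X)) ⟩
      ε * (card (L X) + card X)     ≡⟨ *-distribˡ-+ ε (card (L X)) (card X) ⟩
      ε * card (L X) + ε * card X   ≤⟨ +-mono-≤ (*-card-L≤D X X⊆J) card-bound ⟩
      D + t * D                     ≡⟨ solve 2 (λ t D → D :+ t :* D := (con 1ℚ :+ t) :* D) refl t D ⟩
      (1ℚ + t) * D                  ∎

    value-grows : (1ℚ + t) * ε * V < sumOver (L X ∪ X) v
    value-grows = begin-strict
      (1ℚ + t) * ε * V               ≡⟨ solve 3 (λ t ε V → (con 1ℚ :+ t) :* ε :* V := ε :* V :+ t :* ε :* V)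
                                                refl t ε V ⟩
      ε * V + t * ε * V              <⟨ +-mono-<-≤ εV<L value-bound ⟩
      sumOver (L X) v + sumOver X v  ≡⟨ sumOver-∪ (L-Disjoint X) ⟨
      sumOver (L X ∪ X) v            ∎

  final-card : ∀ {t X} → Stage t X → ε * ε * toℚ (count X) ≤ D
  final-card {t} {X} stage = begin
    ε * ε * toℚ (count X)  ≡⟨ cong (ε * ε *_) (toℚ-count X) ⟩
    ε * ε * card X         ≡⟨ *-assoc ε ε (card X) ⟩
    ε * (ε * card X)       ≤⟨ *-monoˡ-≤-nonNeg ε {{nonNegative ε≥0}} card-bound ⟩
    ε * (t * D)            ≡⟨ solve 3 (λ ε t D → ε :* (t :* D) := t :* ε :* D) refl ε t D ⟩
    t * ε * D              ≤⟨ *-monoʳ-≤-nonNeg D {{nonNegative D≥0}} round-bound ⟩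
    1ℚ * D                 ≡⟨ *-identityˡ D ⟩
    D                      ∎
    where
    open Stage stage
    open ≤-Reasoning

  Result : Set
  Result = Σ (Subset n) λ X → X ⊆ J × ε * ε * toℚ (count X) ≤ D × sumOver (L X) v ≤ ε * V

  -- Every round that does not stop adds at least one item, so n < |X| + fuel is maintained.
  peel : ∀ {t X} (fuel : ℕ) → n ℕ.< count X ℕ.+ fuel → Stage t X → Result
  peel {X = X} zero n<∣X∣+0 _ =
    ⊥-elim (ℕₚ.<⇒≱ (subst (n ℕ.<_) (ℕₚ.+-identityʳ (count X)) n<∣X∣+0) (count≤n X))
  peel {X = X} (suc fuel) n<∣X∣+1+fuel stage with sumOver (L X) v ≤? ε * V
  ... | yes L≤εV = X , Stage.X⊆J stage , final-card stage , L≤εV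
  ... | no  L≰εV = peel fuel n<∣L∪X∣+fuel (grow stage εV<L)
    where
    εV<L : ε * V < sumOver (L X) v
    εV<L = ≰⇒> L≰εV

    ∣L∣≢0 : count (L X) ≢ 0
    ∣L∣≢0 ∣L∣≡0 = <-irrefl refl
      (≤-<-trans εV≥0 (subst (ε * V <_) (count≡0⇒sumOver≡0 (L X) v ∣L∣≡0) εV<L))

    n<∣L∪X∣+fuel : n ℕ.< count (L X ∪ X) ℕ.+ fuel
    n<∣L∪X∣+fuel = ℕₚ.<-≤-trans n<∣X∣+1+fuel (begin
      count X ℕ.+ suc fuel                ≡⟨ ℕₚ.+-suc (count X) fuel ⟩
      suc (count X ℕ.+ fuel)              ≤⟨ ℕₚ.+-monoˡ-≤ (count X ℕ.+ fuel) (ℕₚ.n≢0⇒n>0 ∣L∣≢0) ⟩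
      count (L X) ℕ.+ (count X ℕ.+ fuel)  ≡⟨ ℕₚ.+-assoc (count (L X)) (count X) fuel ⟨
      count (L X) ℕ.+ count X ℕ.+ fuel    ≡⟨ cong (ℕ._+ fuel) (count-∪ (L-Disjoint X)) ⟨
      count (L X ∪ X) ℕ.+ fuel            ∎)
      where open ℕₚ.≤-Reasoning

  result : Result
  result = peel (suc n) (subst (λ c → n ℕ.< c ℕ.+ suc n) (sym (count-∅ {n})) (ℕₚ.n<1+n n)) start

module _ {n k : ℕ} (J : Assignment n k) where

  onMachine⊆inJ : ∀ j → onMachine J j ⊆ inJ J
  onMachine⊆inJ j i with J i
  ... | just _ = λ _ → refl

  just⇒onMachine : ∀ {j i} → J i ≡ just j → onMachine J j i ≡ true
  just⇒onMachine {j} Jᵢ≡j rewrite Jᵢ≡j = trans (isYes≗does (j ≟ᶠ j)) (dec-true (j ≟ᶠ j) refl)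

  assignedVal-nonNeg : {d : ℕ} (I : Instance n k d) → (∀ j i → 0ℚ ≤ Instance.val I j i) →
                       ∀ i → 0ℚ ≤ assignedVal I J i
  assignedVal-nonNeg I val≥0 i with J i
  ... | nothing = ≤-refl
  ... | just j  = val≥0 j i

module LargeItems {n k d : ℕ} (I : Instance n k d) (J : Assignment n k)
  (s≥0 : ∀ j i → 0ℚ ≤ Instance.s I j i) (w≥0 : ∀ q i → 0ℚ ≤ Instance.w I q i)
  (J-fits : ∀ j → sumOver (onMachine J j) (Instance.s I j) ≤ Instance.M I j)
  (J-light : ∀ q → sumOver (inJ J) (Instance.w I q) ≤ Instance.W I q)
  {ε : ℚ} (ε≥0 : 0ℚ ≤ ε) where

  open Instance I

  module _ (X : Subset n) where

    residualCapacity : Fin k → ℚ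
    residualCapacity j = M j - sumOver (X ∩ onMachine J j) (s j)

    residualWeight : Fin d → ℚ
    residualWeight q = W q - sumOver X (w q)

    bulky : Fin k → Subset n
    bulky j = large (onMachine J j) X (s j) (ε * residualCapacity j)

    heavy : Fin d → Subset n
    heavy q = large (inJ J) X (w q) (ε * residualWeight q)

    big : Subset n
    big = ⋃ heavy ∪ ⋃ bulky

    module Heavy (q : Fin d) = Large (inJ J) X (w q) (ε * residualWeight q)
    module Bulky (j : Fin k) = Large (onMachine J j) X (s j) (ε * residualCapacity j)

    big⊆J : big ⊆ inJ J
    big⊆J = ∪-⊆ (⋃-⊆ Heavy.large-⊆) (⋃-⊆ λ j → ⊆-trans (Bulky.large-⊆ j) (onMachine⊆inJ J j))

    big-Disjoint : Disjoint big X
    big-Disjoint = ∪-Disjoint (⋃-Disjoint Heavy.large-Disjoint) (⋃-Disjoint Bulky.large-Disjoint)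

    *-card-heavy≤1 : X ⊆ inJ J → ∀ q → ε * card (heavy q) ≤ 1ℚ
    *-card-heavy≤1 X⊆J q = *-card≤1-residual {ε = ε} (w≥0 q) (Heavy.large-⊆ q) X⊆J
      (Heavy.large-Disjoint q) (J-light q) (Heavy.large-exceeds q)

    *-card-bulky≤1 : ∀ j → ε * card (bulky j) ≤ 1ℚ
    *-card-bulky≤1 j = *-card≤1-residual {ε = ε} (s≥0 j) (Bulky.large-⊆ j) (∩-⊆ʳ {S = X})
      (Disjoint-∩ˡ (Bulky.large-Disjoint j)) (J-fits j) (Bulky.large-exceeds j)

    *-card-big≤ : X ⊆ inJ J → ε * card big ≤ toℚ d + toℚ k
    *-card-big≤ X⊆J = ≤-trans (*-card-∪-≤ ε≥0 (⋃ heavy) (⋃ bulky))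
      (+-mono-≤ (*-card-⋃≤ {F = heavy} ε≥0 (*-card-heavy≤1 X⊆J))
                (*-card-⋃≤ {F = bulky} ε≥0 *-card-bulky≤1))

    ¬big⇒s≤ : ∀ j i → J i ≡ just j → X i ≡ false → big i ≡ false →
              s j i ≤ ε * residualCapacity j
    ¬big⇒s≤ j i Jᵢ≡j Xᵢ bigᵢ =
      Bulky.¬large⇒≤ j i (just⇒onMachine J Jᵢ≡j) Xᵢ
        (⋃≡false bulky i (∨-conicalʳ (⋃ heavy i) _ bigᵢ) j)

    ¬big⇒w≤ : ∀ q i → inJ J i ≡ true → X i ≡ false → big i ≡ false →
              w q i ≤ ε * residualWeight q
    ¬big⇒w≤ q i Jᵢ Xᵢ bigᵢ =
      Heavy.¬large⇒≤ q i Jᵢ Xᵢ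
        (⋃≡false heavy i (∨-conicalˡ (⋃ heavy i) _ bigᵢ) q)

theorem3 : {n k d : ℕ} (I : Instance n k d) (J : Assignment n k) →
  let open Instance I in
  -- nonnegativity of the data
  (∀ j → 0ℚ ≤ M j) →
  (∀ j i → 0ℚ ≤ s j i) →
  (∀ j i → 0ℚ ≤ val j i) →
  (∀ q i → 0ℚ ≤ w q i) →
  -- J is feasible
  (∀ j → sumOver (onMachine J j) (s j) ≤ M j) →
  (∀ q → sumOver (inJ J) (w q) ≤ W q) →
  (ε : ℚ) → 0ℚ < ε →
  Σ (Fin n → Bool) λ X → Σ (Fin n → Bool) λ Y →
    (∀ i → X i ≡ true → inJ J i ≡ true) ×
    (∀ i → Y i ≡ true → inJ J i ≡ true) ×
    -- |X| ≤ (d + k) / ε²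
    (ε * ε * toℚ (count X) ≤ toℚ d + toℚ k) ×
    -- val(Y) ≤ ε · val(J)
    (sumOver Y (assignedVal I J) ≤ ε * sumOver (inJ J) (assignedVal I J)) ×
    (∀ j i → J i ≡ just j → X i ≡ false → Y i ≡ false →
       s j i ≤ ε * (M j - sumOver (λ i' → X i' ∧ onMachine J j i') (s j))) ×
    (∀ q i → inJ J i ≡ true → X i ≡ false → Y i ≡ false →
       w q i ≤ ε * (W q - sumOver X (w q)))
theorem3 {k = k} {d = d} I J _ s≥0 val≥0 w≥0 J-fits J-light ε 0<ε =
  let X , X⊆J , ε²∣X∣≤d+k , val[big]≤εV = result in
  X , big X , X⊆J , big⊆J X , ε²∣X∣≤d+k , val[big]≤εV , ¬big⇒s≤ X , ¬big⇒w≤ X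
  where
  open LargeItems I J s≥0 w≥0 J-fits J-light (<⇒≤ 0<ε)
  open Peeling (inJ J) (assignedVal I J) (assignedVal-nonNeg J I val≥0) (<⇒≤ 0<ε)
    (+-mono-≤ (toℚ-nonNeg d) (toℚ-nonNeg k)) big big⊆J big-Disjoint *-card-big≤
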